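{- Let $a\neq b$ be decimal digits. No absolute prime contains in its decimal representation (at least) three digits equal to $a$ and (at least) two digits equal to $b$ simultaneously.
   Context: An absolute prime is a positive integer which is prime and remains prime after an arbitrary permutation of the digits of its decimal representation. -}

module Defs where

open import Data.Nat using (ℕ)
open import Data.Fin using (Fin; zero)
open import Data.Fin.Properties using (_≟_)
open import Data.List using (List; []; _∷_; length; filter)
open import Data.List.Relation.Binary.Permutation.Propositional using (_↭_)
open import Data.Digit using (Decimal; fromDigits)
open import Data.Nat.Primality using (Prime)
open import Data.Unit using (⊤)
open import Data.Product using (_×_)
open import Relation.Binary.PropositionalEquality using (_≡_; _≢_)

-- Digit lists are least-significant digit first (as in Data.Digit.fromDigits).
-- The most significant digit (the last list element) must be nonzero.
NoLeadingZero : List Decimal → Set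
NoLeadingZero []           = ⊤
NoLeadingZero (d ∷ [])     = d ≢ zero
NoLeadingZero (_ ∷ e ∷ ds) = NoLeadingZero (e ∷ ds)

DecRep : ℕ → List Decimal → Set
DecRep n ds = fromDigits ds ≡ n × NoLeadingZero ds

AbsolutePrime : ℕ → Set
AbsolutePrime n =
  Prime n × (∀ ds → DecRep n ds → ∀ es → es ↭ ds → Prime (fromDigits es))

count : Decimal → List Decimal → ℕ
count a ds = length (filter (_≟ a) ds)

{-# OPTIONS --safe #-}
-- Move three a's and two b's to the five lowest places: the permutations fixing the other
-- digits then read x + R·10⁵ with R fixed and x running over the ten arrangements of aaabb.
-- If a or b is even, some arrangement is even; if both are odd, the arrangements meet every
-- residue class mod 7 (both facts are checked by enumerating all digit pairs). Either way
-- some x + R·10⁵ has the proper divisor 2 or 7.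
module Submission where

open import Defs
open import Data.Nat
  using (ℕ; zero; suc; _+_; _*_; _^_; _%_; _≤_; _<_; _<?_; z≤n; s≤s; NonZero; NonTrivial)
open import Data.Nat.Properties using (*-identityʳ; ≤-trans; ≤-pred; m≤m+n; <-≤-trans)
open import Data.Nat.DivMod using (_mod_; m%n<n; m%n%n≡m%n; %-distribˡ-+; %-distribˡ-*)
open import Data.Nat.Divisibility using (_∣_; _∣?_; m%n≡0⇒n∣m; n∣m⇒m%n≡0)
open import Data.Nat.Primality using (Prime; composite; prime⇒¬composite)
open import Data.Nat.Solver using (module +-*-Solver)
open import Data.Digit using (Decimal; fromDigits)
open import Data.Fin using (Fin; toℕ)
open import Data.Fin.Properties using (_≟_; all?; any?; toℕ-fromℕ<)
open import Data.List using (List; []; _∷_; _++_; [_]; length; filter; take; drop; replicate)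
open import Data.List.Properties
  using (filter-accept; filter-reject; filter-++; length-++; take++drop≡id)
open import Data.List.Relation.Binary.Permutation.Propositional
  using (_↭_; prep; swap; ↭-refl; ↭-trans; ↭-sym; ↭-reflexive)
open import Data.List.Relation.Binary.Permutation.Propositional.Properties
  using (↭-length; filter-↭; shift; ++⁺ʳ)
open import Data.Product using (_×_; ∃-syntax; _,_)
open import Data.Sum using (_⊎_; [_,_]′)
open import Data.Empty using (⊥; ⊥-elim)
open import Function using (_∘_; id)
open import Relation.Nullary using (¬_; Dec; yes; no)
open import Relation.Nullary.Decidable using (toWitness; _⊎-dec_; _×-dec_)
open import Relation.Binary.PropositionalEquality
  using (_≡_; _≢_; refl; sym; trans; cong; subst; module ≡-Reasoning)

private
  variable
    A : Set
    c x : Decimal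
    xs ys : List Decimal

count-↭ : ∀ c → xs ↭ ys → count c xs ≡ count c ys
count-↭ c p = ↭-length (filter-↭ (_≟ c) p)

count-∷-≡ : ∀ c xs → count c (c ∷ xs) ≡ suc (count c xs)
count-∷-≡ c _ = cong length (filter-accept (_≟ c) refl)

count-∷-≢ : x ≢ c → count c (x ∷ xs) ≡ count c xs
count-∷-≢ {c = c} x≢c = cong length (filter-reject (_≟ c) x≢c)

count-++ : ∀ xs ys → count c (xs ++ ys) ≡ count c xs + count c ys
count-++ {c} xs ys = trans (cong length (filter-++ (_≟ c) xs ys)) (length-++ (filter (_≟ c) xs))

count-replicate-≢ : x ≢ c → ∀ m → count c (replicate m x) ≡ 0
count-replicate-≢ x≢c zero    = refl
count-replicate-≢ x≢c (suc m) = trans (count-∷-≢ x≢c) (count-replicate-≢ x≢c m)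

count-↭replicate++ : x ≢ c → ∀ {m zs} → xs ↭ replicate m x ++ zs → count c xs ≡ count c zs
count-↭replicate++ {x} {c} {xs} x≢c {m} {zs} xs↭ = begin
  count c xs                           ≡⟨ count-↭ c xs↭ ⟩
  count c (replicate m x ++ zs)        ≡⟨ count-++ (replicate m x) zs ⟩
  count c (replicate m x) + count c zs ≡⟨ cong (_+ count c zs) (count-replicate-≢ x≢c m) ⟩
  count c zs                           ∎
  where open ≡-Reasoning

count-pos⇒↭∷ : ∀ xs → 1 ≤ count c xs → ∃[ zs ] xs ↭ c ∷ zs
count-pos⇒↭∷ {c} (x ∷ xs) pos with x ≟ c
... | yes refl = xs , ↭-refl
... | no _ with count-pos⇒↭∷ xs pos
...   | zs , p = x ∷ zs , ↭-trans (prep x p) (swap x c ↭-refl)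

count-≥⇒↭replicate++ : ∀ m xs → m ≤ count c xs → ∃[ zs ] xs ↭ replicate m c ++ zs
count-≥⇒↭replicate++         zero    xs _  = xs , ↭-refl
count-≥⇒↭replicate++ {c} (suc m) xs le with count-pos⇒↭∷ xs (≤-trans (s≤s z≤n) le)
... | xs′ , xs↭ with count-≥⇒↭replicate++ m xs′ (≤-pred (subst (suc m ≤_) count-xs le))
  where
  count-xs : count c xs ≡ suc (count c xs′)
  count-xs = trans (count-↭ c xs↭) (count-∷-≡ c xs′)
...   | zs , xs′↭ = zs , ↭-trans xs↭ (prep c xs′↭)

insert : ℕ → A → List A → List A
insert k v xs = take k xs ++ [ v ] ++ drop k xs

insert-↭ : ∀ k (v : A) xs → insert k v xs ↭ v ∷ xs
insert-↭ k v xs =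
  ↭-trans (shift v (take k xs) (drop k xs)) (prep v (↭-reflexive (take++drop≡id k xs)))

fromDigits-++ : ∀ {base} (xs ys : List (Fin base)) →
  fromDigits (xs ++ ys) ≡ fromDigits xs + fromDigits ys * base ^ length xs
fromDigits-++         []       ys = sym (*-identityʳ (fromDigits ys))
fromDigits-++ {base} (x ∷ xs) ys rewrite fromDigits-++ xs ys =
  solve 5 (λ t f g p b → t :+ (f :+ g :* p) :* b := (t :+ f :* b) :+ g :* (b :* p))
    refl (toℕ x) (fromDigits xs) (fromDigits ys) (base ^ length xs) base
  where open +-*-Solver

[m+n*o]%d≡[m+k*o]%d : ∀ m n k o d .{{_ : NonZero d}} → n % d ≡ k % d →
  (m + n * o) % d ≡ (m + k * o) % d
[m+n*o]%d≡[m+k*o]%d m n k o d n≡k = begin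
  (m + n * o) % d                           ≡⟨ %-distribˡ-+ m (n * o) d ⟩
  (m % d + n * o % d) % d                   ≡⟨ cong (λ t → (m % d + t) % d) (%-distribˡ-* n o d) ⟩
  (m % d + (n % d) * (o % d) % d) % d       ≡⟨ cong (λ t → (m % d + t * (o % d) % d) % d) n≡k ⟩
  (m % d + (k % d) * (o % d) % d) % d       ≡⟨ cong (λ t → (m % d + t) % d) (%-distribˡ-* k o d) ⟨
  (m % d + k * o % d) % d                   ≡⟨ %-distribˡ-+ m (k * o) d ⟨
  (m + k * o) % d                           ∎
  where open ≡-Reasoning

d∣m+[n-mod-d]*o⇒d∣m+n*o : ∀ d .{{_ : NonZero d}} m n o →
  d ∣ m + toℕ (n mod d) * o → d ∣ m + n * o
d∣m+[n-mod-d]*o⇒d∣m+n*o d m n o d∣ = m%n≡0⇒n∣m _ d (trans (%-cong n≡n%d) (n∣m⇒m%n≡0 _ d d∣))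
  where
  %-cong = [m+n*o]%d≡[m+k*o]%d m n (toℕ (n mod d)) o d
  n≡n%d : n % d ≡ toℕ (n mod d) % d
  n≡n%d = sym (trans (cong (_% d) (toℕ-fromℕ< (m%n<n n d))) (m%n%n≡m%n n d))

∣⇒¬Prime : ∀ {d n} .{{_ : NonTrivial d}} → d < n → d ∣ n → ¬ Prime n
∣⇒¬Prime d<n d∣n p = prime⇒¬composite p (composite d<n d∣n)

arrangement : Decimal → Decimal → Fin 5 → Fin 4 → List Decimal
arrangement a b i j = insert (toℕ i) b (insert (toℕ j) b (a ∷ a ∷ a ∷ []))

arrangement-↭ : ∀ a b i j → arrangement a b i j ↭ b ∷ b ∷ a ∷ a ∷ a ∷ []
arrangement-↭ a b i j = ↭-trans (insert-↭ (toℕ i) b _) (prep b (insert-↭ (toℕ j) b _))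

-- r plays the role of the residue mod d of R, the number formed by the remaining digits
DivisibleArrangement : (d r : ℕ) → Decimal → Decimal → Set
DivisibleArrangement d r a b =
  ∃[ i ] ∃[ j ] let x = fromDigits (arrangement a b i j) in d < x × d ∣ x + r * 10 ^ 5

divisibleArrangement? : ∀ d r a b → Dec (DivisibleArrangement d r a b)
divisibleArrangement? d r a b = any? λ i → any? λ j →
  let x = fromDigits (arrangement a b i j) in (d <? x) ×-dec (d ∣? x + r * 10 ^ 5)

divisibleArrangement-table : ∀ a b (r₂ : Fin 2) (r₇ : Fin 7) →
  a ≡ b ⊎ (DivisibleArrangement 2 (toℕ r₂) a b ⊎ DivisibleArrangement 7 (toℕ r₇) a b)
divisibleArrangement-table = toWitness {a? = all? λ a → all? λ b → all? λ r₂ → all? λ r₇ →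
  (a ≟ b) ⊎-dec
  (divisibleArrangement? 2 (toℕ r₂) a b ⊎-dec divisibleArrangement? 7 (toℕ r₇) a b)} _

divisibleArrangement-2-or-7 : ∀ a b → a ≢ b → (r₂ : Fin 2) (r₇ : Fin 7) →
  DivisibleArrangement 2 (toℕ r₂) a b ⊎ DivisibleArrangement 7 (toℕ r₇) a b
divisibleArrangement-2-or-7 a b a≢b r₂ r₇ =
  [ ⊥-elim ∘ a≢b , id ]′ (divisibleArrangement-table a b r₂ r₇)

lemma3 : (a b : Decimal) → a ≢ b → (n : ℕ) → AbsolutePrime n →
    (ds : List Decimal) → DecRep n ds → ¬ (3 ≤ count a ds × 2 ≤ count b ds)
lemma3 a b a≢b n (_ , perm-prime) ds rep (3≤a , 2≤b)
  with count-≥⇒↭replicate++ 2 ds 2≤b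
... | zs , ds↭
  with count-≥⇒↭replicate++ 3 zs (subst (3 ≤_) (count-↭replicate++ (a≢b ∘ sym) {2} ds↭) 3≤a)
... | rest , zs↭ =
  [ not-prime 2 , not-prime 7 ]′ (divisibleArrangement-2-or-7 a b a≢b (R mod 2) (R mod 7))
  where
  R = fromDigits rest

  ds↭bbaaa++rest : ds ↭ b ∷ b ∷ a ∷ a ∷ a ∷ rest
  ds↭bbaaa++rest = ↭-trans ds↭ (prep b (prep b zs↭))

  prime-arrangement : ∀ i j → Prime (fromDigits (arrangement a b i j) + R * 10 ^ 5)
  prime-arrangement i j = subst Prime digits (perm-prime ds rep (arr ++ rest) arr++rest↭ds)
    where
    arr = arrangement a b i j
    arr++rest↭ds : arr ++ rest ↭ ds
    arr++rest↭ds = ↭-trans (++⁺ʳ rest (arrangement-↭ a b i j)) (↭-sym ds↭bbaaa++rest)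
    digits : fromDigits (arr ++ rest) ≡ fromDigits arr + R * 10 ^ 5
    digits rewrite fromDigits-++ arr rest | ↭-length (arrangement-↭ a b i j) = refl

  not-prime : ∀ d .{{_ : NonZero d}} .{{_ : NonTrivial d}} →
    DivisibleArrangement d (toℕ (R mod d)) a b → ⊥
  not-prime d (i , j , d<x , d∣) = ∣⇒¬Prime (<-≤-trans d<x (m≤m+n _ _))
    (d∣m+[n-mod-d]*o⇒d∣m+n*o d _ R (10 ^ 5) d∣) (prime-arrangement i j)
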